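{- Let $\ell\in\mathcal{L}$ and let $A,B$ be games in $\mathcal{G}_{\mathcal{L}}$. Then: (1) if $\ell\le\ell'$, then $T_{\ell'}A$ is protected at level $\ell$; (2) if $B$ is protected at level $\ell$, so are $A\multimap B$ and $A\Rightarrow B$; (3) if $A$ and $B$ are protected at level $\ell$, so are $A\,\&\,B$ and $A\otimes B$; (4) if $A$ is protected at level $\ell$, so is $!A$; (5) $I$ is protected at level $\ell$.
   Context: Security semilattice $(\mathcal{L},\sqcup,\bot)$, $\ell\le\ell'$ iff $\ell\sqcup\ell'=\ell'$. Games in $\mathcal{G}_{\mathcal{L}}$ are justified AJM games $A$ (moves $M_A$, O/P and Q/A labels, a well-founded partial justification function whose undefined points are the initial moves $\mathsf{Init}_A$, plays, and an equivalence on plays) together with a level map $\mathsf{lev}_A:M_A\to\mathcal{L}$. Constructions: $I$ has no moves. $A\otimes B$ and $A\,\&\,B$ have move set $M_A+M_B$ with justification and levels componentwise (so initial moves are those of $A$ and of $B$). $A\multimap B$ has moves $(\mathsf{Init}_B\times M_A)+M_B$, where an initial $A$-move in copy $b$ is justified by $b\in\mathsf{Init}_B$, other justification componentwise, levels componentwise (so its initial moves are exactly those of $B$). $!A$ has moves $\omega\times M_A$ with $\mathsf{j}(i,m)=(i,\mathsf{j}_A(m))$ and $\mathsf{lev}(i,m)=\mathsf{lev}_A(m)$. $A\Rightarrow B={!A}\multimap B$. $T_\ell A$ is $A$ with $\mathsf{lev}_{T_\ell A}(m)=\mathsf{lev}_A(m)\sqcup\ell$. $\mathsf{Level}(A)=\{\mathsf{lev}_A(m)\mid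 m\in\mathsf{Init}_A\}$. $A$ is protected at level $\ell$ if $\ell'\ge\ell$ for all $\ell'\in\mathsf{Level}(A)$. -}

module Defs where

open import Level using (Level; _⊔_; suc; 0ℓ)
open import Data.Nat using (ℕ)
open import Data.Product using (Σ; ∃; _×_; _,_; proj₁; proj₂)
open import Data.Sum using (_⊎_; inj₁; inj₂)
open import Data.Empty using (⊥)
open import Data.Maybe using (Maybe; just; nothing)
open import Relation.Binary.PropositionalEquality using (_≡_; refl)
open import Induction.WellFounded using (WellFounded; Acc; acc)
open import Algebra.Lattice.Bundles using (BoundedJoinSemilattice)

data OP : Set where
  O P : OP

data QA : Set where
  Q A : QA

flipOP : OP → OP
flipOP O = P
flipOP P = O

module Games {c ℓ : Level} (𝓛 : BoundedJoinSemilattice c ℓ) where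

  open BoundedJoinSemilattice 𝓛 public using (_≈_) renaming (Carrier to Lab; _∨_ to _⊔ᴸ_; ⊥ to ⊥ᴸ)

  _≤ᴸ_ : Lab → Lab → Set ℓ
  l ≤ᴸ l' = (l ⊔ᴸ l') ≈ l'

  JustRel : {M : Set} → (M → Maybe M) → M → M → Set
  JustRel j m' m = j m ≡ just m'

  record Game : Set (suc 0ℓ ⊔ c) where
    field
      Move   : Set
      λOP    : Move → OP
      λQA    : Move → QA
      just?  : Move → Maybe Move
      wf     : WellFounded (JustRel just?)
      lev    : Move → Lab

  open Game public

  Init : (G : Game) → Move G → Set
  Init G m = just? G m ≡ nothing

  _∈Level_ : Lab → Game → Set c
  l ∈Level G = Σ (Move G) λ m → Init G m × lev G m ≡ l

  Protected : Game → Lab → Set (c ⊔ ℓ)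
  Protected G l = ∀ l' → l' ∈Level G → l ≤ᴸ l'

  I : Game
  I = record { Move = ⊥ ; λOP = λ () ; λQA = λ () ; just? = λ ()
             ; wf = λ () ; lev = λ () }

  private
    mapJ₁ : {X Y : Set} → Maybe X → Maybe (X ⊎ Y)
    mapJ₁ nothing = nothing
    mapJ₁ (just x) = just (inj₁ x)

    mapJ₂ : {X Y : Set} → Maybe Y → Maybe (X ⊎ Y)
    mapJ₂ nothing = nothing
    mapJ₂ (just y) = just (inj₂ y)

    sumJ : {X Y : Set} → (X → Maybe X) → (Y → Maybe Y) → X ⊎ Y → Maybe (X ⊎ Y)
    sumJ jx jy (inj₁ x) = mapJ₁ (jx x)
    sumJ jx jy (inj₂ y) = mapJ₂ (jy y)

    acc₁ : {X Y : Set} (jx : X → Maybe X) (jy : Y → Maybe Y) (x : X) →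
           Acc (JustRel jx) x → Acc (JustRel (sumJ jx jy)) (inj₁ x)
    acc₁ jx jy x (acc rs) = acc (λ {y} e → go y (jx x) refl e)
      where
      go : ∀ y (mx : Maybe _) → jx x ≡ mx → mapJ₁ mx ≡ just y →
           Acc (JustRel (sumJ jx jy)) y
      go .(inj₁ x') (just x') eq refl = acc₁ jx jy x' (rs eq)

    acc₂ : {X Y : Set} (jx : X → Maybe X) (jy : Y → Maybe Y) (y : Y) →
           Acc (JustRel jy) y → Acc (JustRel (sumJ jx jy)) (inj₂ y)
    acc₂ jx jy y (acc rs) = acc (λ {z} e → go z (jy y) refl e)
      where
      go : ∀ z (my : Maybe _) → jy y ≡ my → mapJ₂ my ≡ just z →
           Acc (JustRel (sumJ jx jy)) z
      go .(inj₂ y') (just y') eq refl = acc₂ jx jy y' (rs eq)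

    sumWF : {X Y : Set} (jx : X → Maybe X) (jy : Y → Maybe Y) →
            WellFounded (JustRel jx) → WellFounded (JustRel jy) →
            WellFounded (JustRel (sumJ jx jy))
    sumWF jx jy wx wy (inj₁ x) = acc₁ jx jy x (wx x)
    sumWF jx jy wx wy (inj₂ y) = acc₂ jx jy y (wy y)

    [_,_] : {X Y : Set} {Z : Set c} → (X → Z) → (Y → Z) → X ⊎ Y → Z
    [ f , g ] (inj₁ x) = f x
    [ f , g ] (inj₂ y) = g y

    [_,_]₀ : {X Y Z : Set} → (X → Z) → (Y → Z) → X ⊎ Y → Z
    [ f , g ]₀ (inj₁ x) = f x
    [ f , g ]₀ (inj₂ y) = g y

  _⊗_ : Game → Game → Game
  G ⊗ H = record
    { Move  = Move G ⊎ Move H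
    ; λOP   = [ λOP G , λOP H ]₀
    ; λQA   = [ λQA G , λQA H ]₀
    ; just? = sumJ (just? G) (just? H)
    ; wf    = sumWF (just? G) (just? H) (wf G) (wf H)
    ; lev   = [ lev G , lev H ]
    }

  _&_ : Game → Game → Game
  G & H = record
    { Move  = Move G ⊎ Move H
    ; λOP   = [ λOP G , λOP H ]₀
    ; λQA   = [ λQA G , λQA H ]₀
    ; just? = sumJ (just? G) (just? H)
    ; wf    = sumWF (just? G) (just? H) (wf G) (wf H)
    ; lev   = [ lev G , lev H ]
    }

  module Lin (G H : Game) where
    InitH : Set
    InitH = Σ (Move H) (Init H)

    M : Set
    M = (InitH × Move G) ⊎ Move H

    jA : InitH → Maybe (Move G) → Maybe M
    jA b nothing   = just (inj₂ (proj₁ b))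
    jA b (just m') = just (inj₁ (b , m'))

    j : M → Maybe M
    j (inj₁ (b , m)) = jA b (just? G m)
    j (inj₂ n)       = mapJ₂ (just? H n)

    accH : ∀ n → Acc (JustRel (just? H)) n → Acc (JustRel j) (inj₂ n)
    accH n (acc rs) = acc (λ {z} e → go z (just? H n) refl e)
      where
      go : ∀ z (mn : Maybe (Move H)) → just? H n ≡ mn → mapJ₂ mn ≡ just z →
           Acc (JustRel j) z
      go .(inj₂ n') (just n') eq refl = accH n' (rs eq)

    accG : ∀ b m → Acc (JustRel (just? G)) m → Acc (JustRel j) (inj₁ (b , m))
    accG b m (acc rs) = acc (λ {z} e → go z (just? G m) refl e)
      where
      go : ∀ z (mm : Maybe (Move G)) → just? G m ≡ mm → jA b mm ≡ just z →
           Acc (JustRel j) z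
      go .(inj₂ (proj₁ b)) nothing eq refl = accH (proj₁ b) (wf H (proj₁ b))
      go .(inj₁ (b , m')) (just m') eq refl = accG b m' (rs eq)

    wfj : WellFounded (JustRel j)
    wfj (inj₁ (b , m)) = accG b m (wf G m)
    wfj (inj₂ n)       = accH n (wf H n)

  _⊸_ : Game → Game → Game
  G ⊸ H = record
    { Move  = M
    ; λOP   = [ (λ p → flipOP (λOP G (proj₂ p))) , λOP H ]₀
    ; λQA   = [ (λ p → λQA G (proj₂ p)) , λQA H ]₀
    ; just? = j
    ; wf    = wfj
    ; lev   = [ (λ p → lev G (proj₂ p)) , lev H ]
    }
    where open Lin G H

  module Bang (G : Game) where
    j : ℕ × Move G → Maybe (ℕ × Move G)
    j (i , m) = go (just? G m)
      where
      go : Maybe (Move G) → Maybe (ℕ × Move G)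
      go nothing = nothing
      go (just m') = just (i , m')

    accB : ∀ i m → Acc (JustRel (just? G)) m → Acc (JustRel j) (i , m)
    accB i m (acc rs) = acc (λ {z} e → go z (just? G m) refl e)
      where
      go : ∀ z (mm : Maybe (Move G)) → just? G m ≡ mm →
           j (i , m) ≡ just z → Acc (JustRel j) z
      go z nothing eq e with just? G m
      go z nothing refl () | .nothing
      go z (just m') eq e with just? G m
      go .(i , m') (just m') refl refl | .(just m') = accB i m' (rs refl)

    wfj : WellFounded (JustRel j)
    wfj (i , m) = accB i m (wf G m)

  !_ : Game → Game
  ! G = record
    { Move  = ℕ × Move G
    ; λOP   = λ p → λOP G (proj₂ p)
    ; λQA   = λ p → λQA G (proj₂ p)
    ; just? = j
    ; wf    = wfj
    ; lev   = λ p → lev G (proj₂ p)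
    }
    where open Bang G

  _⇒_ : Game → Game → Game
  G ⇒ H = (! G) ⊸ H

  T : Lab → Game → Game
  T l G = record
    { Move = Move G ; λOP = λOP G ; λQA = λQA G ; just? = just? G
    ; wf = wf G ; lev = λ m → lev G m ⊔ᴸ l }

  infixr 5 _⊸_ _⇒_
  infixr 6 _⊗_ _&_
  infix 7 !_

module Submission where

-- Protection is a property of the set Level(G) of levels of initial moves,
-- and it is antitone in that set: if every level of G is a level of H (or of
-- H or K), protection of H (and K) transfers to G.  Each construction is then
-- handled by computing where its initial moves come from:
--   * A ⊸ B (hence A ⇒ B = !A ⊸ B) has exactly B's initial moves, since an
--     A-move in a copy b is always justified (by b or by an A-move);
--   * A ⊗ B and A & B have the initial moves of A and those of B;
--   * !A has copies of A's initial moves, at the same levels;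
--   * T_ℓ' A has A's initial moves, at levels raised by ℓ', and ℓ ≤ ℓ'
--     implies ℓ ≤ m ⊔ ℓ' for every m;
--   * I has no moves at all.

open import Defs
open import Level using (Level)
open import Data.Product using (_×_; _,_; ∃)
open import Data.Sum using (_⊎_; inj₁; inj₂)
open import Data.Maybe using (just; nothing)
open import Relation.Binary.PropositionalEquality using (_≡_; refl)
open import Algebra.Lattice.Bundles using (BoundedJoinSemilattice)

module Protection {c ℓ : Level} (𝓛 : BoundedJoinSemilattice c ℓ) where
  open Games 𝓛
  open BoundedJoinSemilattice 𝓛 using (sym; assoc; comm; ∨-cong) renaming (refl to ≈-refl)
  open import Relation.Binary.Reasoning.Setoid (BoundedJoinSemilattice.setoid 𝓛)

  ≤-⊔-right : ∀ {l l'} m → l ≤ᴸ l' → l ≤ᴸ (m ⊔ᴸ l')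
  ≤-⊔-right {l} {l'} m l≤l' = begin
    l ⊔ᴸ (m ⊔ᴸ l') ≈⟨ sym (assoc l m l') ⟩
    (l ⊔ᴸ m) ⊔ᴸ l' ≈⟨ ∨-cong (comm l m) ≈-refl ⟩
    (m ⊔ᴸ l) ⊔ᴸ l' ≈⟨ assoc m l l' ⟩
    m ⊔ᴸ (l ⊔ᴸ l') ≈⟨ ∨-cong ≈-refl l≤l' ⟩
    m ⊔ᴸ l'        ∎

  protected-⊆ : ∀ G H {l} → (∀ {l'} → l' ∈Level G → l' ∈Level H) →
                Protected H l → Protected G l
  protected-⊆ G H G⊆H prH l' l'∈G = prH l' (G⊆H l'∈G)

  protected-∪ : ∀ G H K {l} → (∀ {l'} → l' ∈Level G → l' ∈Level H ⊎ l' ∈Level K) →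
                Protected H l → Protected K l → Protected G l
  protected-∪ G H K G⊆H∪K prH prK l' l'∈G with G⊆H∪K l'∈G
  ... | inj₁ l'∈H = prH l' l'∈H
  ... | inj₂ l'∈K = prK l' l'∈K

  -- The initial moves of A ⊸ B are those of B: an A-move in copy b is
  -- justified by b if A-initial, and by an A-move otherwise.
  levels-⊸ : ∀ G H {l'} → l' ∈Level (G ⊸ H) → l' ∈Level H
  levels-⊸ G H (inj₁ (_ , m) , _ , _) with just? G m
  levels-⊸ G H (inj₁ _ , () , _) | nothing
  levels-⊸ G H (inj₁ _ , () , _) | just _
  levels-⊸ G H (inj₂ n , _ , lev≡) with just? H n in eq
  ... | nothing = n , eq , lev≡
  levels-⊸ G H (inj₂ _ , () , _) | just _

  levels-⊗ : ∀ G H {l'} → l' ∈Level (G ⊗ H) → l' ∈Level G ⊎ l' ∈Level H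
  levels-⊗ G H (inj₁ m , _ , lev≡) with just? G m in eq
  ... | nothing = inj₁ (m , eq , lev≡)
  levels-⊗ G H (inj₁ _ , () , _) | just _
  levels-⊗ G H (inj₂ n , _ , lev≡) with just? H n in eq
  ... | nothing = inj₂ (n , eq , lev≡)
  levels-⊗ G H (inj₂ _ , () , _) | just _

  -- A & B has literally the same arena and levels as A ⊗ B.
  levels-& : ∀ G H {l'} → l' ∈Level (G & H) → l' ∈Level G ⊎ l' ∈Level H
  levels-& = levels-⊗

  levels-! : ∀ G {l'} → l' ∈Level (! G) → l' ∈Level G
  levels-! G ((_ , m) , _ , lev≡) with just? G m in eq
  ... | nothing = m , eq , lev≡
  levels-! G (_ , () , _) | just _

  levels-T : ∀ G l' {l''} → l'' ∈Level (T l' G) →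
             ∃ λ m → l'' ≡ m ⊔ᴸ l' × m ∈Level G
  levels-T G l' (m , init , refl) = lev G m , refl , m , init , refl

  protected-T : ∀ {l} G l' → l ≤ᴸ l' → Protected (T l' G) l
  protected-T G l' l≤l' l'' l''∈T with levels-T G l' l''∈T
  ... | m , refl , _ = ≤-⊔-right m l≤l'

  protected-I : ∀ l → Protected I l
  protected-I l l' (() , _)

mainTheorem7 : {c ℓ : Level} (𝓛 : BoundedJoinSemilattice c ℓ) →
    let open Games 𝓛 in
    (l : Lab) (A B : Game) →
    ((l' : Lab) → l ≤ᴸ l' → Protected (T l' A) l)
    × (Protected B l → Protected (A ⊸ B) l × Protected (A ⇒ B) l)
    × (Protected A l → Protected B l → Protected (A & B) l × Protected (A ⊗ B) l)
    × (Protected A l → Protected (! A) l)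
    × Protected I l
mainTheorem7 𝓛 l G H =
    protected-T G
  , (λ prH → protected-⊆ (G ⊸ H) H (levels-⊸ G H) prH
           , protected-⊆ (G ⇒ H) H (levels-⊸ (! G) H) prH)
  , (λ prG prH → protected-∪ (G & H) G H (levels-& G H) prG prH
               , protected-∪ (G ⊗ H) G H (levels-⊗ G H) prG prH)
  , protected-⊆ (! G) G (levels-! G)
  , protected-I l
  where open Games 𝓛
        open Protection 𝓛
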